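{- Let $l\geq1$ and let $c_1,\dots,c_l$ and $d_1,\dots,d_l$ be positive integers. Let $u$ be a vertex of a connected graph $G$ such that $G$ contains a path $P_{\max\{c_1,\dots,c_l\}+1}$ as a proper subgraph, with $u$ as one of the leaves of this path. Let $P_{d_1+1},\dots,P_{d_l+1}$ be paths that are mutually vertex-disjoint and vertex-disjoint from $G$, and let $v_i$ be a leaf of $P_{d_i+1}$ for $i=1,\dots,l$. Let $H$ be the graph obtained from the disjoint union of $G,P_{d_1+1},\dots,P_{d_l+1}$ by identifying all of $u,v_1,\dots,v_l$ into a single vertex. Then for all $k\geq 0$ $$M_k(H)\geq M_k(G)+\sum_{i=1}^l\left(M_k(P_{c_i+d_i+1})-M_k(P_{c_i+1})\right).$$
   Context: All graphs are finite simple graphs; $P_m$ is the path on $m$ vertices; a leaf of a path is one of its two end vertices. $M_k(G)$ denotes the number of closed walks of length $k$ in $G$. The graph $H$ is denoted in the paper by $G(u=v_1)P_{d_1+1}\cdots(u=v_l)P_{d_l+1}$ (iterated coalescence at $u$). -}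

module Defs where

open import Data.Nat using (ℕ; zero; suc; _+_; _*_; _⊔_; _≡ᵇ_)
open import Data.Bool using (Bool; true; false; if_then_else_; _∧_; _∨_)
open import Data.Fin using (Fin; toℕ) renaming (zero to fzero; suc to fsuc)
import Data.Fin.Properties as FinP
open import Data.List using (List; []; _∷_; map; _++_; concatMap; allFin)
open import Data.Empty using (⊥)
open import Data.Sum using (_⊎_; inj₁; inj₂)
import Data.Sum.Properties as SumP
open import Data.Product using (Σ; _,_; _×_)
import Data.Product.Properties as ProdP
open import Relation.Binary.Definitions using (DecidableEquality)
open import Relation.Binary.PropositionalEquality using (_≡_)
open import Relation.Nullary.Decidable using (does; ⌊_⌋)

-- A finite graph given by an explicit enumeration of its vertex type
-- (each vertex listed exactly once), decidable equality and a Boolean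
-- adjacency relation.
record Graph : Set₁ where
  field
    V     : Set
    elems : List V
    eq?   : DecidableEquality V
    adj   : V → V → Bool
open Graph public

sumL : {A : Set} → List A → (A → ℕ) → ℕ
sumL []       f = 0
sumL (x ∷ xs) f = f x + sumL xs f

b2n : Bool → ℕ
b2n true  = 1
b2n false = 0

walks : (G : Graph) → ℕ → V G → V G → ℕ
walks G zero    v w = b2n (does (eq? G v w))
walks G (suc k) v w = sumL (elems G) (λ x → b2n (adj G v x) * walks G k x w)

M : ℕ → Graph → ℕ
M k G = sumL (elems G) (λ v → walks G k v v)

record SimpleGraph (n : ℕ) : Set where
  field
    sadj   : Fin n → Fin n → Bool
    sym    : ∀ x y → sadj x y ≡ sadj y x
    irrefl : ∀ x → sadj x x ≡ false
open SimpleGraph public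

toGraph : {n : ℕ} → SimpleGraph n → Graph
toGraph {n} G = record { V = Fin n ; elems = allFin n ; eq? = FinP._≟_ ; adj = sadj G }

pathAdj : {m : ℕ} → Fin m → Fin m → Bool
pathAdj i j = (suc (toℕ i) ≡ᵇ toℕ j) ∨ (suc (toℕ j) ≡ᵇ toℕ i)

P : ℕ → Graph
P m = record { V = Fin m ; elems = allFin m ; eq? = FinP._≟_ ; adj = pathAdj }

data Reach {n : ℕ} (G : SimpleGraph n) : Fin n → Fin n → Set where
  here : ∀ {a} → Reach G a a
  step : ∀ {a b c} → sadj G a b ≡ true → Reach G b c → Reach G a c

Connected : {n : ℕ} → SimpleGraph n → Set
Connected {n} G = ∀ (a b : Fin n) → Reach G a b

maxF : {l : ℕ} → (Fin l → ℕ) → ℕ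
maxF {zero}  c = 0
maxF {suc l} c = c fzero ⊔ maxF (λ i → c (fsuc i))

-- Vertices: inj₁ a for a vertex of G (u plays the role of the merged
-- vertex u=v_1=...=v_l), and inj₂ (i , j) for the vertex j+1 of the
-- i-th path P_{d_i+1} (whose vertices are 0,...,d_i, with v_i = 0).
HV : (n l : ℕ) → (Fin l → ℕ) → Set
HV n l d = Fin n ⊎ Σ (Fin l) (λ i → Fin (d i))

coalesce : {n l : ℕ} → SimpleGraph n → Fin n → (d : Fin l → ℕ) → Graph
coalesce {n} {l} G u d = record
  { V = HV n l d
  ; elems = map inj₁ (allFin n)
            ++ concatMap (λ i → map (λ j → inj₂ (i , j)) (allFin (d i))) (allFin l)
  ; eq? = SumP.≡-dec FinP._≟_ (ProdP.≡-dec FinP._≟_ FinP._≟_)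
  ; adj = adjH
  }
  where
  adjH : HV n l d → HV n l d → Bool
  adjH (inj₁ a) (inj₁ b) = sadj G a b
  adjH (inj₁ a) (inj₂ (i , j)) = ⌊ a FinP.≟ u ⌋ ∧ (toℕ j ≡ᵇ 0)
  adjH (inj₂ (i , j)) (inj₁ a) = ⌊ a FinP.≟ u ⌋ ∧ (toℕ j ≡ᵇ 0)
  adjH (inj₂ (i , j)) (inj₂ (i' , j')) =
    ⌊ i FinP.≟ i' ⌋ ∧ ((suc (toℕ j) ≡ᵇ toℕ j') ∨ (suc (toℕ j') ≡ᵇ toℕ j))

-- G contains the path P_{m+1} as a proper subgraph, with u a leaf of it:
-- an injective map f from the vertices of P_{m+1} to those of G sending
-- path edges to edges of G, with f(leaf) = u, and the image subgraph is
-- not the whole of G (some vertex is missed, or some edge of G is not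
-- the image of a path edge).
ProperPathAt : {n : ℕ} → SimpleGraph n → Fin n → ℕ → Set
ProperPathAt {n} G u m =
  Σ (Fin (suc m) → Fin n) λ f →
    (∀ i j → f i ≡ f j → i ≡ j)
    × (∀ i j → pathAdj i j ≡ true → sadj G (f i) (f j) ≡ true)
    × ((f fzero ≡ u) ⊎ (f (Data.Fin.fromℕ m) ≡ u))
    × ((Σ (Fin n) λ w → ∀ i → (f i ≡ w → ⊥))
       ⊎ (Σ (Fin n) λ x → Σ (Fin n) λ y → (sadj G x y ≡ true)
            × (∀ i j → f i ≡ x → f j ≡ y → pathAdj i j ≡ false)))

module Submission where

-- Split the closed walks of a graph B according to whether they visit a vertex set T.
-- Those avoiding T are the closed walks of B − T, so M_k(B) = M_k(B − T) + (closed walks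
-- meeting T).  If Q embeds in B with T_Q mapped into T_B, walks meeting T_Q map injectively
-- to walks meeting T_B, whence M_k(B − T_B) + M_k(Q) ≤ M_k(B) + M_k(Q − T_Q).
-- Take B = H, T_B = the vertices of one pendant path P_{d_i+1} other than u, and
-- Q = P_{c_i+d_i+1}, laid out backwards along the given path of G ending at u and then
-- along the pendant path, with T_Q its last d_i vertices (so Q − T_Q = P_{c_i+1}).
-- Removing the pendant paths one at a time and adding up gives the claim.

open import Defs hiding (sym)
open import Data.Bool using (Bool; true; false; if_then_else_; _∧_; _∨_)
open import Data.Bool.Properties using (T-≡; T-∨)
open import Data.Empty using (⊥-elim)
open import Data.Fin using (Fin; toℕ; splitAt; join; _↑ˡ_; opposite; inject≤)
  renaming (zero to fzero; suc to fsuc)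
import Data.Fin.Properties as FinP
open import Data.List using (List; []; _∷_; map; _++_; concatMap; tabulate; allFin)
open import Data.Nat using (ℕ; zero; suc; _+_; _*_; _∸_; _≤_; _<_; z≤n; s≤s; _≡ᵇ_)
open import Data.Nat.Properties hiding (eq?)
open import Algebra.Properties.CommutativeSemigroup +-commutativeSemigroup
  using (interchange; x∙yz≈y∙xz; x∙yz≈yx∙z; x∙yz≈xz∙y)
open import Data.Product using (∃; _,_; proj₁; proj₂; _×_)
open import Data.Sum using (_⊎_; inj₁; inj₂; [_,_]′)
import Data.Sum as Sum
import Data.Sum.Properties as SumP
open import Function using (_∘_; const)
open import Function.Bundles using (Equivalence)
open import Function.Definitions using (Injective)
open import Relation.Nullary using (¬_; Dec; yes; no; does)
open import Relation.Nullary.Decidable using (⌊_⌋; ⌊⌋-map′; isYes≗does; dec-true; dec-false)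
open import Relation.Binary.Definitions using (DecidableEquality)
open import Relation.Binary.PropositionalEquality

δ : {A : Set} → DecidableEquality A → A → A → ℕ
δ _≟_ x y = b2n (does (x ≟ y))

module _ {A : Set} (_≟_ : DecidableEquality A) where

  δ-≡ : ∀ {x y} → x ≡ y → δ _≟_ x y ≡ 1
  δ-≡ {x} {y} x≡y = cong b2n (dec-true (x ≟ y) x≡y)

  δ-≢ : ∀ {x y} → ¬ x ≡ y → δ _≟_ x y ≡ 0
  δ-≢ {x} {y} x≢y = cong b2n (dec-false (x ≟ y) x≢y)

  δ-*-swap : ∀ x y (g : A → ℕ) → δ _≟_ x y * g y ≡ δ _≟_ x y * g x
  δ-*-swap x y g with x ≟ y
  ... | yes refl = refl
  ... | no _     = refl

  δ-sym : ∀ x y → δ _≟_ x y ≡ δ _≟_ y x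
  δ-sym x y with x ≟ y
  ... | yes refl = sym (δ-≡ refl)
  ... | no x≢y   = sym (δ-≢ (x≢y ∘ sym))

δ-injective : {A B : Set} (_≟ᴬ_ : DecidableEquality A) (_≟ᴮ_ : DecidableEquality B)
  {f : A → B} → Injective _≡_ _≡_ f → ∀ x y → δ _≟ᴮ_ (f x) (f y) ≡ δ _≟ᴬ_ x y
δ-injective _≟ᴬ_ _≟ᴮ_ f-inj x y with x ≟ᴬ y
... | yes refl = δ-≡ _≟ᴮ_ refl
... | no x≢y   = δ-≢ _≟ᴮ_ (x≢y ∘ f-inj)

module _ {A : Set} where

  sumL-cong : ∀ xs {f g : A → ℕ} → (∀ x → f x ≡ g x) → sumL xs f ≡ sumL xs g
  sumL-cong []       f≡g = refl
  sumL-cong (x ∷ xs) f≡g = cong₂ _+_ (f≡g x) (sumL-cong xs f≡g)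

  sumL-mono : ∀ xs {f g : A → ℕ} → (∀ x → f x ≤ g x) → sumL xs f ≤ sumL xs g
  sumL-mono []       f≤g = z≤n
  sumL-mono (x ∷ xs) f≤g = +-mono-≤ (f≤g x) (sumL-mono xs f≤g)

  sumL-zero : ∀ xs {f : A → ℕ} → (∀ x → f x ≡ 0) → sumL xs f ≡ 0
  sumL-zero []       f≡0 = refl
  sumL-zero (x ∷ xs) f≡0 = cong₂ _+_ (f≡0 x) (sumL-zero xs f≡0)

  sumL-+ : ∀ xs (f g : A → ℕ) → sumL xs (λ x → f x + g x) ≡ sumL xs f + sumL xs g
  sumL-+ []       f g = refl
  sumL-+ (x ∷ xs) f g = trans (cong (f x + g x +_) (sumL-+ xs f g))
                              (interchange (f x) (g x) (sumL xs f) (sumL xs g))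

  sumL-*ʳ : ∀ xs (f : A → ℕ) a → sumL xs (λ x → f x * a) ≡ sumL xs f * a
  sumL-*ʳ []       f a = refl
  sumL-*ʳ (x ∷ xs) f a = trans (cong (f x * a +_) (sumL-*ʳ xs f a))
                               (sym (*-distribʳ-+ a (f x) (sumL xs f)))

  sumL-++ : ∀ xs ys (f : A → ℕ) → sumL (xs ++ ys) f ≡ sumL xs f + sumL ys f
  sumL-++ []       ys f = refl
  sumL-++ (x ∷ xs) ys f = trans (cong (f x +_) (sumL-++ xs ys f)) (sym (+-assoc (f x) _ _))

module _ {A B : Set} where

  sumL-map : ∀ (g : A → B) xs (f : B → ℕ) → sumL (map g xs) f ≡ sumL xs (f ∘ g)
  sumL-map g []       f = refl
  sumL-map g (x ∷ xs) f = cong (f (g x) +_) (sumL-map g xs f)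

  sumL-concatMap : ∀ (g : A → List B) xs (f : B → ℕ)
    → sumL (concatMap g xs) f ≡ sumL xs (λ x → sumL (g x) f)
  sumL-concatMap g []       f = refl
  sumL-concatMap g (x ∷ xs) f =
    trans (sumL-++ (g x) (concatMap g xs) f) (cong (sumL (g x) f +_) (sumL-concatMap g xs f))

  sumL-swap : ∀ xs ys (h : A → B → ℕ)
    → sumL xs (λ x → sumL ys (h x)) ≡ sumL ys (λ y → sumL xs (λ x → h x y))
  sumL-swap []       ys h = sym (sumL-zero ys (λ _ → refl))
  sumL-swap (x ∷ xs) ys h =
    trans (cong (sumL ys (h x) +_) (sumL-swap xs ys h)) (sym (sumL-+ ys (h x) _))

sumL-tabulate : {B : Set} (n : ℕ) (g : Fin n → B) (f : B → ℕ)
  → sumL (tabulate g) f ≡ sumL (allFin n) (f ∘ g)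
sumL-tabulate zero    g f = refl
sumL-tabulate (suc n) g f =
  cong (f (g fzero) +_) (trans (sumL-tabulate n (g ∘ fsuc) f) (sym (sumL-tabulate n fsuc (f ∘ g))))

sumL-allFin-suc : ∀ n (f : Fin (suc n) → ℕ) → sumL (allFin (suc n)) f ≡ f fzero + sumL (allFin n) (f ∘ fsuc)
sumL-allFin-suc n f = cong (f fzero +_) (sumL-tabulate n fsuc f)

record Enumerates {A : Set} (_≟_ : DecidableEquality A) (xs : List A) : Set where
  field occurs-once : ∀ x → sumL xs (λ x′ → δ _≟_ x′ x) ≡ 1
open Enumerates public

Enumerated : Graph → Set
Enumerated G = Enumerates (eq? G) (elems G)

module _ {X Y : Set} (_≟_ : DecidableEquality Y) where

  preimageCount : (X → Y) → List X → Y → ℕ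
  preimageCount φ xs y = sumL xs (δ _≟_ y ∘ φ)

  preimageCount-∉ : ∀ φ xs y → (∀ x → ¬ φ x ≡ y) → preimageCount φ xs y ≡ 0
  preimageCount-∉ φ xs y y∉ = sumL-zero xs (λ x → δ-≢ _≟_ (y∉ x ∘ sym))

  preimageCount-≡0⊎∈image : ∀ φ xs y → preimageCount φ xs y ≡ 0 ⊎ ∃ λ x → φ x ≡ y
  preimageCount-≡0⊎∈image φ []       y = inj₁ refl
  preimageCount-≡0⊎∈image φ (x ∷ xs) y with φ x ≟ y
  ... | yes φx≡y = inj₂ (x , φx≡y)
  ... | no φx≢y  = Sum.map₁ (cong₂ _+_ (δ-≢ _≟_ (φx≢y ∘ sym)))
                           (preimageCount-≡0⊎∈image φ xs y)

  module _ {_≟ˣ_ : DecidableEquality X} {xs : List X} (xs-enum : Enumerates _≟ˣ_ xs)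
           (φ : X → Y) (φ-inj : Injective _≡_ _≡_ φ) where

    preimageCount-image : ∀ x → preimageCount φ xs (φ x) ≡ 1
    preimageCount-image x =
      trans (sumL-cong xs (λ x′ → trans (δ-injective _≟ˣ_ _≟_ φ-inj x x′) (δ-sym _≟ˣ_ x x′)))
            (occurs-once xs-enum x)

    preimageCount≤1 : ∀ y → preimageCount φ xs y ≤ 1
    preimageCount≤1 y with preimageCount-≡0⊎∈image φ xs y
    ... | inj₁ ≡0         = ≤-trans (≤-reflexive ≡0) z≤n
    ... | inj₂ (x , refl) = ≤-reflexive (preimageCount-image x)

  sumL-∘-by-preimageCount : ∀ {ys} → Enumerates _≟_ ys → ∀ (φ : X → Y) xs (g : Y → ℕ)
    → sumL xs (g ∘ φ) ≡ sumL ys (λ y → preimageCount φ xs y * g y)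
  sumL-∘-by-preimageCount {ys} ys-enum φ xs g = begin
    sumL xs (g ∘ φ)
      ≡⟨ sumL-cong xs (λ x → trans (cong (_* g (φ x)) (occurs-once ys-enum (φ x))) (+-identityʳ (g (φ x)))) ⟨
    sumL xs (λ x → sumL ys (λ y → δ _≟_ y (φ x)) * g (φ x))
      ≡⟨ sumL-cong xs (λ x → sym (sumL-*ʳ ys (λ y → δ _≟_ y (φ x)) (g (φ x)))) ⟩
    sumL xs (λ x → sumL ys (λ y → δ _≟_ y (φ x) * g (φ x)))
      ≡⟨ sumL-cong xs (λ x → sumL-cong ys (λ y → δ-*-swap _≟_ y (φ x) g)) ⟩
    sumL xs (λ x → sumL ys (λ y → δ _≟_ y (φ x) * g y))
      ≡⟨ sumL-swap xs ys (λ x y → δ _≟_ y (φ x) * g y) ⟩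
    sumL ys (λ y → sumL xs (λ x → δ _≟_ y (φ x) * g y))
      ≡⟨ sumL-cong ys (λ y → sumL-*ʳ xs (δ _≟_ y ∘ φ) (g y)) ⟩
    sumL ys (λ y → preimageCount φ xs y * g y) ∎
    where open ≡-Reasoning

module _ {X Y : Set} {_≟ˣ_ : DecidableEquality X} {_≟_ : DecidableEquality Y}
         {xs : List X} (xs-enum : Enumerates _≟ˣ_ xs) {ys : List Y} (ys-enum : Enumerates _≟_ ys)
         {φ : X → Y} (φ-inj : Injective _≡_ _≡_ φ) where

  sumL-∘-injective-≤ : ∀ g → sumL xs (g ∘ φ) ≤ sumL ys g
  sumL-∘-injective-≤ g = begin
    sumL xs (g ∘ φ)                                  ≡⟨ sumL-∘-by-preimageCount _≟_ ys-enum φ xs g ⟩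
    sumL ys (λ y → preimageCount _≟_ φ xs y * g y)   ≤⟨ sumL-mono ys count≤ ⟩
    sumL ys g                                        ∎
    where
    open ≤-Reasoning
    count≤ : ∀ y → preimageCount _≟_ φ xs y * g y ≤ g y
    count≤ y = ≤-trans (*-monoˡ-≤ (g y) (preimageCount≤1 _≟_ xs-enum φ φ-inj y))
                       (≤-reflexive (*-identityˡ (g y)))

  sumL-∘-injective : ∀ g → (∀ y → (∃ λ x → φ x ≡ y) ⊎ g y ≡ 0) → sumL xs (g ∘ φ) ≡ sumL ys g
  sumL-∘-injective g g-off-image =
    trans (sumL-∘-by-preimageCount _≟_ ys-enum φ xs g) (sumL-cong ys count≡)
    where
    count≡ : ∀ y → preimageCount _≟_ φ xs y * g y ≡ g y
    count≡ y with g-off-image y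
    ... | inj₁ (x , refl) = trans (cong (_* g y) (preimageCount-image _≟_ xs-enum φ φ-inj x)) (+-identityʳ (g y))
    ... | inj₂ gy≡0       = trans (cong (preimageCount _≟_ φ xs y *_) gy≡0)
                                  (trans (*-zeroʳ (preimageCount _≟_ φ xs y)) (sym gy≡0))

module _ (G : Graph) (T : V G → Bool) where

  walksAvoiding : ℕ → V G → V G → ℕ
  walksAvoiding zero    x y = if T x then 0 else walks G zero x y
  walksAvoiding (suc k) x y = if T x then 0 else sumL (elems G) (λ z → b2n (adj G x z) * walksAvoiding k z y)

  walksTouching : ℕ → V G → V G → ℕ
  walksTouching zero    x y = if T x then walks G zero x y else 0
  walksTouching (suc k) x y = if T x then walks G (suc k) x y
                              else sumL (elems G) (λ z → b2n (adj G x z) * walksTouching k z y)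

  closedWalksTouching : ℕ → ℕ
  closedWalksTouching k = sumL (elems G) (λ w → walksTouching k w w)

  walks≡avoiding+touching : ∀ k x y → walks G k x y ≡ walksAvoiding k x y + walksTouching k x y
  walks≡avoiding+touching zero x y with T x
  ... | true  = refl
  ... | false = sym (+-identityʳ _)
  walks≡avoiding+touching (suc k) x y with T x
  ... | true  = refl
  ... | false = trans (sumL-cong (elems G) split-step) (sumL-+ (elems G) _ _)
    where
    split-step : ∀ z → b2n (adj G x z) * walks G k z y
                     ≡ b2n (adj G x z) * walksAvoiding k z y + b2n (adj G x z) * walksTouching k z y
    split-step z = trans (cong (b2n (adj G x z) *_) (walks≡avoiding+touching k z y))
                         (*-distribˡ-+ (b2n (adj G x z)) _ _)

  walksAvoiding-from-T : ∀ k x y → T x ≡ true → walksAvoiding k x y ≡ 0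
  walksAvoiding-from-T zero    x y Tx rewrite Tx = refl
  walksAvoiding-from-T (suc k) x y Tx rewrite Tx = refl

  walksTouching≤walks : ∀ k x y → walksTouching k x y ≤ walks G k x y
  walksTouching≤walks k x y = subst (walksTouching k x y ≤_) (sym (walks≡avoiding+touching k x y)) (m≤n+m _ _)

  M≡avoiding+touching : ∀ k → M k G ≡ sumL (elems G) (λ w → walksAvoiding k w w) + closedWalksTouching k
  M≡avoiding+touching k = trans (sumL-cong (elems G) (λ w → walks≡avoiding+touching k w w)) (sumL-+ (elems G) _ _)

record Embedding (A B : Graph) : Set where
  field
    embed           : V A → V B
    embed-injective : Injective _≡_ _≡_ embed
    embed-adj       : ∀ x z → adj A x z ≡ true → adj B (embed x) (embed z) ≡ true
open Embedding public

b2n-mono : ∀ {a b} → (a ≡ true → b ≡ true) → b2n a ≤ b2n b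
b2n-mono {false} _   = z≤n
b2n-mono {true}  a⇒b rewrite a⇒b refl = s≤s z≤n

module _ {A B : Graph} (A-enum : Enumerated A) (B-enum : Enumerated B) (f : Embedding A B) where

  private
    φ : V A → V B
    φ = embed f

    step-mono : ∀ x {h : V A → ℕ} {h′ : V B → ℕ} → (∀ z → h z ≤ h′ (φ z))
      → sumL (elems A) (λ z → b2n (adj A x z) * h z) ≤ sumL (elems B) (λ w → b2n (adj B (φ x) w) * h′ w)
    step-mono x {h} {h′} h≤h′ = ≤-trans
      (sumL-mono (elems A) (λ z → *-mono-≤ (b2n-mono (embed-adj f x z)) (h≤h′ z)))
      (sumL-∘-injective-≤ A-enum B-enum (embed-injective f) (λ w → b2n (adj B (φ x) w) * h′ w))

  walks-mono : ∀ k x y → walks A k x y ≤ walks B k (φ x) (φ y)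
  walks-mono zero    x y = ≤-reflexive (sym (δ-injective (eq? A) (eq? B) (embed-injective f) x y))
  walks-mono (suc k) x y = step-mono x (λ z → walks-mono k z y)

  module _ (TA : V A → Bool) (TB : V B → Bool) (T-preserved : ∀ x → TA x ≡ true → TB (φ x) ≡ true) where

    walksTouching-mono : ∀ k x y → walksTouching A TA k x y ≤ walksTouching B TB k (φ x) (φ y)
    walksTouching-mono zero x y with TA x in TAx | TB (φ x) in TBφx
    ... | true  | false with () ← trans (sym (T-preserved x TAx)) TBφx
    ... | true  | true  = walks-mono zero x y
    ... | false | _     = z≤n
    walksTouching-mono (suc k) x y with TA x in TAx | TB (φ x) in TBφx
    ... | true  | false with () ← trans (sym (T-preserved x TAx)) TBφx
    ... | true  | true  = walks-mono (suc k) x y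
    ... | false | true  = step-mono x (λ z → ≤-trans (walksTouching≤walks A TA k z y) (walks-mono k z y))
    ... | false | false = step-mono x (λ z → walksTouching-mono k z y)

    closedWalksTouching-mono : ∀ k → closedWalksTouching A TA k ≤ closedWalksTouching B TB k
    closedWalksTouching-mono k = ≤-trans
      (sumL-mono (elems A) (λ x → walksTouching-mono k x x))
      (sumL-∘-injective-≤ A-enum B-enum (embed-injective f) (λ w → walksTouching B TB k w w))

record _≅_∖_ (C A : Graph) (T : V A → Bool) : Set where
  field
    include           : V C → V A
    include-injective : Injective _≡_ _≡_ include
    include-adj       : ∀ x z → adj A (include x) (include z) ≡ adj C x z
    include-∉         : ∀ x → T (include x) ≡ false
    include-onto      : ∀ w → T w ≡ false → ∃ λ z → include z ≡ w

module _ {C A : Graph} (C-enum : Enumerated C) (A-enum : Enumerated A)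
         {T : V A → Bool} (C≅A∖T : C ≅ A ∖ T) where
  open _≅_∖_ C≅A∖T

  private
    sumL-include : ∀ (g : V A → ℕ) → (∀ w → T w ≡ true → g w ≡ 0)
      → sumL (elems C) (g ∘ include) ≡ sumL (elems A) g
    sumL-include g g-on-T = sumL-∘-injective C-enum A-enum include-injective g off-image
      where
      off-image : ∀ w → (∃ λ z → include z ≡ w) ⊎ g w ≡ 0
      off-image w with T w in Tw
      ... | true  = inj₂ (g-on-T w Tw)
      ... | false = inj₁ (include-onto w Tw)

  walksAvoiding-include : ∀ k x y → walksAvoiding A T k (include x) (include y) ≡ walks C k x y
  walksAvoiding-include zero x y rewrite include-∉ x = δ-injective (eq? C) (eq? A) include-injective x y
  walksAvoiding-include (suc k) x y rewrite include-∉ x = begin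
    sumL (elems A) (λ w → b2n (adj A (include x) w) * walksAvoiding A T k w (include y))
      ≡⟨ sumL-include _ (λ w Tw → trans (cong (b2n (adj A (include x) w) *_) (walksAvoiding-from-T A T k w _ Tw))
                                        (*-zeroʳ (b2n (adj A (include x) w)))) ⟨
    sumL (elems C) (λ z → b2n (adj A (include x) (include z)) * walksAvoiding A T k (include z) (include y))
      ≡⟨ sumL-cong (elems C) (λ z → cong₂ (λ a w → b2n a * w) (include-adj x z)
                                          (walksAvoiding-include k z y)) ⟩
    sumL (elems C) (λ z → b2n (adj C x z) * walks C k z y) ∎
    where open ≡-Reasoning

  M-deletion : ∀ k → M k A ≡ M k C + closedWalksTouching A T k
  M-deletion k = trans (M≡avoiding+touching A T k) (cong (_+ closedWalksTouching A T k) avoiding≡M)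
    where
    avoiding≡M : sumL (elems A) (λ w → walksAvoiding A T k w w) ≡ M k C
    avoiding≡M = trans (sym (sumL-include _ (λ w → walksAvoiding-from-T A T k w w)))
                       (sumL-cong (elems C) (λ z → walksAvoiding-include k z z))

  M-deletion-≤ : ∀ k → M k C ≤ M k A
  M-deletion-≤ k = subst (M k C ≤_) (sym (M-deletion k)) (m≤m+n _ _)

M-exchange : ∀ {A B Q R : Graph} → Enumerated A → Enumerated B → Enumerated Q → Enumerated R
  → {TB : V B → Bool} {TQ : V Q → Bool} → A ≅ B ∖ TB → R ≅ Q ∖ TQ
  → (f : Embedding Q B) → (∀ x → TQ x ≡ true → TB (embed f x) ≡ true)
  → ∀ k → M k A + M k Q ≤ M k B + M k R
M-exchange {A} {B} {Q} {R} A-enum B-enum Q-enum R-enum {TB} {TQ} A≅B∖TB R≅Q∖TQ f T-preserved k = begin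
  M k A + M k Q                                 ≡⟨ cong (M k A +_) (M-deletion R-enum Q-enum R≅Q∖TQ k) ⟩
  M k A + (M k R + closedWalksTouching Q TQ k)  ≤⟨ +-monoʳ-≤ (M k A) (+-monoʳ-≤ (M k R) touching≤) ⟩
  M k A + (M k R + closedWalksTouching B TB k)  ≡⟨ x∙yz≈xz∙y (M k A) (M k R) _ ⟩
  (M k A + closedWalksTouching B TB k) + M k R  ≡⟨ cong (_+ M k R) (M-deletion A-enum B-enum A≅B∖TB k) ⟨
  M k B + M k R                                 ∎
  where
  open ≤-Reasoning
  touching≤ : closedWalksTouching Q TQ k ≤ closedWalksTouching B TB k
  touching≤ = closedWalksTouching-mono Q-enum B-enum f TQ TB T-preserved k

Adjacent : ℕ → ℕ → Set
Adjacent x y = suc x ≡ y ⊎ suc y ≡ x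

-- pathAdj i j unfolds to adjacentᵇ (toℕ i) (toℕ j), whatever the lengths of the paths of i and j.
adjacentᵇ : ℕ → ℕ → Bool
adjacentᵇ x y = (suc x ≡ᵇ y) ∨ (suc y ≡ᵇ x)

module _ {m : ℕ} {i j : Fin m} where

  pathAdj⇒Adjacent : pathAdj i j ≡ true → Adjacent (toℕ i) (toℕ j)
  pathAdj⇒Adjacent p = Sum.map (≡ᵇ⇒≡ _ _) (≡ᵇ⇒≡ _ _) (Equivalence.to T-∨ (Equivalence.from T-≡ p))

  Adjacent⇒pathAdj : Adjacent (toℕ i) (toℕ j) → pathAdj i j ≡ true
  Adjacent⇒pathAdj a = Equivalence.to T-≡ (Equivalence.from T-∨ (Sum.map (≡⇒≡ᵇ _ _) (≡⇒≡ᵇ _ _) a))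

∸-Adjacent : ∀ {a b c} → a ≤ c → b ≤ c → Adjacent a b → Adjacent (c ∸ a) (c ∸ b)
∸-Adjacent _   b≤c (inj₁ refl) = inj₂ (sym (+-∸-assoc 1 b≤c))
∸-Adjacent a≤c _   (inj₂ refl) = inj₁ (sym (+-∸-assoc 1 a≤c))

Adjacent-+ˡ⁻ : ∀ k {x y} → Adjacent (k + x) (k + y) → Adjacent x y
Adjacent-+ˡ⁻ k {x} {y} = Sum.map (λ e → +-cancelˡ-≡ k _ _ (trans (+-suc k x) e))
                                 (λ e → +-cancelˡ-≡ k _ _ (trans (+-suc k y) e))

Adjacent-across : ∀ {a c j} → a ≤ c → Adjacent a (suc c + j) → a ≡ c × j ≡ 0
Adjacent-across {a} {c} {j} a≤c (inj₁ e) = trans a≡c+j (trans (cong (c +_) j≡0) (+-identityʳ c)) , j≡0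
  where
  a≡c+j : a ≡ c + j
  a≡c+j = suc-injective e
  j≡0 : j ≡ 0
  j≡0 = n≤0⇒n≡0 (+-cancelˡ-≤ c j 0 (subst₂ _≤_ a≡c+j (sym (+-identityʳ c)) a≤c))
Adjacent-across {a} {c} {j} a≤c (inj₂ e) =
  ⊥-elim (≤⇒≯ a≤c (subst (c <_) e (m<n⇒m<1+n (s≤s (m≤m+n c j)))))

opposite-injective : ∀ {m} → Injective _≡_ _≡_ (opposite {m})
opposite-injective {_} {i} {j} eq = FinP.toℕ-injective (suc-injective
  (∸-cancelˡ-≡ (FinP.toℕ<n i) (FinP.toℕ<n j)
    (trans (sym (FinP.opposite-prop i)) (trans (cong toℕ eq) (FinP.opposite-prop j)))))

pathAdj-opposite : ∀ {m} {i j : Fin m} → pathAdj i j ≡ true → pathAdj (opposite i) (opposite j) ≡ true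
pathAdj-opposite {i = i} {j} p = Adjacent⇒pathAdj
  (subst₂ Adjacent (sym (FinP.opposite-prop i)) (sym (FinP.opposite-prop j))
  (∸-Adjacent (FinP.toℕ<n i) (FinP.toℕ<n j) (Sum.map (cong suc) (cong suc) (pathAdj⇒Adjacent p))))

record PathFrom {n : ℕ} (G : SimpleGraph n) (u : Fin n) (m : ℕ) : Set where
  field
    vertex           : Fin (suc m) → Fin n
    vertex-injective : Injective _≡_ _≡_ vertex
    vertex-adj       : ∀ i j → pathAdj i j ≡ true → sadj G (vertex i) (vertex j) ≡ true
    vertex-start     : vertex fzero ≡ u

properPath⇒PathFrom : ∀ {n} {G : SimpleGraph n} {u m} → ProperPathAt G u m → PathFrom G u m
properPath⇒PathFrom (f , f-inj , f-adj , inj₁ f0≡u , _) = record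
  { vertex = f ; vertex-injective = f-inj _ _ ; vertex-adj = f-adj ; vertex-start = f0≡u }
properPath⇒PathFrom (f , f-inj , f-adj , inj₂ fm≡u , _) = record
  { vertex           = f ∘ opposite
  ; vertex-injective = opposite-injective ∘ f-inj _ _
  ; vertex-adj       = λ i j → f-adj (opposite i) (opposite j) ∘ pathAdj-opposite {i = i} {j}
  ; vertex-start     = fm≡u
  }

allFin-enumerates : ∀ n → Enumerates FinP._≟_ (allFin n)
allFin-enumerates n = record { occurs-once = once n }
  where
  once : ∀ n (i : Fin n) → sumL (allFin n) (λ j → δ FinP._≟_ j i) ≡ 1
  once (suc n) fzero    = trans (sumL-allFin-suc n (λ j → δ FinP._≟_ j fzero))
                                (cong suc (sumL-zero (allFin n) (λ _ → refl)))
  once (suc n) (fsuc i) = trans (sumL-allFin-suc n (λ j → δ FinP._≟_ j (fsuc i))) (once n i)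

P-enumerated : ∀ m → Enumerated (P m)
P-enumerated = allFin-enumerates

toGraph-enumerated : ∀ {n} (G : SimpleGraph n) → Enumerated (toGraph G)
toGraph-enumerated {n} _ = allFin-enumerates n

module _ {n : ℕ} (G : SimpleGraph n) (u : Fin n) where

  coalesce-enumerated : ∀ {l} (d : Fin l → ℕ) → Enumerated (coalesce G u d)
  coalesce-enumerated {l} d = record { occurs-once = λ v → trans (split-count v) (count v) }
    where
    _≟ᴴ_ : DecidableEquality (HV n l d)
    _≟ᴴ_ = eq? (coalesce G u d)
    pendant : (i : Fin l) → Fin (d i) → HV n l d
    pendant i j = inj₂ (i , j)
    pendantCount : HV n l d → Fin l → ℕ
    pendantCount v i = preimageCount _≟ᴴ_ (pendant i) (allFin (d i)) v

    split-count : ∀ v → sumL (elems (coalesce G u d)) (λ w → δ _≟ᴴ_ w v)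
                      ≡ preimageCount _≟ᴴ_ inj₁ (allFin n) v + sumL (allFin l) (pendantCount v)
    split-count v = trans (sumL-++ (map inj₁ (allFin n)) _ _) (cong₂ _+_
      (trans (sumL-map inj₁ (allFin n) _) (sumL-cong (allFin n) (λ a → δ-sym _≟ᴴ_ (inj₁ a) v)))
      (trans (sumL-concatMap (λ i → map (pendant i) (allFin (d i))) (allFin l) _)
             (sumL-cong (allFin l) (λ i → trans (sumL-map (pendant i) (allFin (d i)) _)
                                                (sumL-cong (allFin (d i)) (λ j → δ-sym _≟ᴴ_ (pendant i j) v))))))

    pendantCount-δ : ∀ i₀ j₀ i → pendantCount (inj₂ (i₀ , j₀)) i ≡ δ FinP._≟_ i i₀
    pendantCount-δ i₀ j₀ i with i FinP.≟ i₀
    ... | yes refl = preimageCount-image _≟ᴴ_ (allFin-enumerates (d i)) (pendant i) (λ { refl → refl }) j₀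
    ... | no i≢i₀  = preimageCount-∉ _≟ᴴ_ (pendant i) (allFin (d i)) (inj₂ (i₀ , j₀))
                                     (λ j e → i≢i₀ (cong first-index e))
      where
      first-index : HV n l d → Fin l
      first-index (inj₁ _)       = i
      first-index (inj₂ (i′ , _)) = i′

    count : ∀ v → preimageCount _≟ᴴ_ inj₁ (allFin n) v + sumL (allFin l) (pendantCount v) ≡ 1
    count (inj₁ b) = cong₂ _+_
      (preimageCount-image _≟ᴴ_ (allFin-enumerates n) inj₁ (λ { refl → refl }) b)
      (sumL-zero (allFin l) (λ i → preimageCount-∉ _≟ᴴ_ (pendant i) (allFin (d i)) (inj₁ b) (λ _ ())))
    count (inj₂ (i₀ , j₀)) = cong₂ _+_
      (preimageCount-∉ _≟ᴴ_ inj₁ (allFin n) (inj₂ (i₀ , j₀)) (λ _ ()))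
      (trans (sumL-cong (allFin l) (pendantCount-δ i₀ j₀)) (occurs-once (allFin-enumerates l) i₀))

  coalesce-noPendants : (d : Fin 0 → ℕ) → toGraph G ≅ coalesce G u d ∖ const false
  coalesce-noPendants d = record
    { include           = inj₁
    ; include-injective = λ { refl → refl }
    ; include-adj       = λ _ _ → refl
    ; include-∉         = λ _ → refl
    ; include-onto      = λ { (inj₁ a) _ → a , refl ; (inj₂ (() , _)) _ }
    }

  onFirstPendant : ∀ {l} (d : Fin (suc l) → ℕ) → HV n (suc l) d → Bool
  onFirstPendant d (inj₁ _)             = false
  onFirstPendant d (inj₂ (fzero , _))   = true
  onFirstPendant d (inj₂ (fsuc _ , _))  = false

  coalesce-dropFirst : ∀ {l} (d : Fin (suc l) → ℕ)
    → coalesce G u (d ∘ fsuc) ≅ coalesce G u d ∖ onFirstPendant d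
  coalesce-dropFirst {l} d = record
    { include           = shift
    ; include-injective = λ { {inj₁ _} {inj₁ _} refl → refl ; {inj₂ _} {inj₂ _} refl → refl
                            ; {inj₁ _} {inj₂ _} () ; {inj₂ _} {inj₁ _} () }
    ; include-adj       = λ { (inj₁ _) (inj₁ _) → refl ; (inj₁ _) (inj₂ _) → refl
                            ; (inj₂ _) (inj₁ _) → refl ; (inj₂ (i , j)) (inj₂ (i′ , j′))
                                → cong (_∧ adjacentᵇ (toℕ j) (toℕ j′)) (⌊⌋-map′ _ _ (i FinP.≟ i′)) }
    ; include-∉         = λ { (inj₁ _) → refl ; (inj₂ _) → refl }
    ; include-onto      = λ { (inj₁ a) _ → inj₁ a , refl ; (inj₂ (fsuc i , j)) _ → inj₂ (i , j) , refl
                            ; (inj₂ (fzero , _)) () }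
    }
    where
    shift : HV n l (d ∘ fsuc) → HV n (suc l) d
    shift (inj₁ a)       = inj₁ a
    shift (inj₂ (i , j)) = inj₂ (fsuc i , j)

module _ (c e : ℕ) where

  beyondPrefix : Fin (suc (c + e)) → Bool
  beyondPrefix = [ const false , const true ]′ ∘ splitAt (suc c)

  prefix-deletion : P (suc c) ≅ P (suc (c + e)) ∖ beyondPrefix
  prefix-deletion = record
    { include           = _↑ˡ e
    ; include-injective = FinP.↑ˡ-injective e _ _
    ; include-adj       = λ x z → cong₂ adjacentᵇ (FinP.toℕ-↑ˡ x e) (FinP.toℕ-↑ˡ z e)
    ; include-∉         = λ x → cong [ const false , const true ]′ (FinP.splitAt-↑ˡ (suc c) x e)
    ; include-onto      = onto
    }
    where
    onto : ∀ t → beyondPrefix t ≡ false → ∃ λ a → a ↑ˡ e ≡ t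
    onto t p  with splitAt (suc c) {e} t in eq
    onto t p  | inj₁ a = a , FinP.splitAt⁻¹-↑ˡ eq
    onto t () | inj₂ _

  position : Fin (suc c) ⊎ Fin e → ℕ
  position = [ toℕ , (λ j → suc c + toℕ j) ]′

  toℕ≡position : ∀ t → toℕ t ≡ position (splitAt (suc c) t)
  toℕ≡position t = trans (cong toℕ (sym (FinP.join-splitAt (suc c) e t))) (toℕ-join (splitAt (suc c) t))
    where
    toℕ-join : ∀ s → toℕ (join (suc c) e s) ≡ position s
    toℕ-join (inj₁ a) = FinP.toℕ-↑ˡ a e
    toℕ-join (inj₂ j) = FinP.toℕ-↑ʳ (suc c) j

module _ {n l m : ℕ} {G : SimpleGraph n} {u : Fin n} (γ : PathFrom G u m)
         (d : Fin (suc l) → ℕ) {c : ℕ} (c≤m : c ≤ m) where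
  open PathFrom γ

  private
    e : ℕ
    e = d fzero

    toℕ≤c : (a : Fin (suc c)) → toℕ a ≤ c
    toℕ≤c = FinP.toℕ≤pred[n]

  reversed : Fin (suc c) → Fin (suc m)
  reversed a = inject≤ (opposite a) (s≤s c≤m)

  toℕ-reversed : ∀ a → toℕ (reversed a) ≡ c ∸ toℕ a
  toℕ-reversed a = trans (FinP.toℕ-inject≤ (opposite a) _) (FinP.opposite-prop a)

  -- The first c + 1 vertices of P_{c+e+1} run backwards along γ and end at u; the last e
  -- run along the first pendant path.
  glue : Fin (suc c) ⊎ Fin e → HV n (suc l) d
  glue (inj₁ a) = inj₁ (vertex (reversed a))
  glue (inj₂ j) = inj₂ (fzero , j)

  glue-injective : Injective _≡_ _≡_ glue
  glue-injective {inj₁ _} {inj₁ _}  eq   =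
    cong inj₁ (opposite-injective (FinP.inject≤-injective _ _ _ _ (vertex-injective (SumP.inj₁-injective eq))))
  glue-injective {inj₂ _} {inj₂ _}  refl = refl
  glue-injective {inj₁ _} {inj₂ _}  ()
  glue-injective {inj₂ _} {inj₁ _}  ()

  glue-attach : ∀ (a : Fin (suc c)) (j : Fin e) → Adjacent (toℕ a) (suc c + toℕ j)
    → (⌊ vertex (reversed a) FinP.≟ u ⌋ ∧ (toℕ j ≡ᵇ 0)) ≡ true
  glue-attach a j p = cong₂ _∧_ (trans (isYes≗does u?) (dec-true u? reaches-u)) (cong (_≡ᵇ 0) (proj₂ across))
    where
    u? : Dec (vertex (reversed a) ≡ u)
    u? = vertex (reversed a) FinP.≟ u
    across : toℕ a ≡ c × toℕ j ≡ 0
    across = Adjacent-across (toℕ≤c a) p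
    reaches-u : vertex (reversed a) ≡ u
    reaches-u = trans (cong vertex (FinP.toℕ-injective {j = fzero}
                  (trans (toℕ-reversed a) (trans (cong (c ∸_) (proj₁ across)) (n∸n≡0 c)))))
                  vertex-start

  glue-adj : ∀ s s′ → Adjacent (position c e s) (position c e s′)
    → adj (coalesce G u d) (glue s) (glue s′) ≡ true
  glue-adj (inj₁ a) (inj₁ a′) p = vertex-adj _ _ (Adjacent⇒pathAdj
    (subst₂ Adjacent (sym (toℕ-reversed a)) (sym (toℕ-reversed a′))
      (∸-Adjacent (toℕ≤c a) (toℕ≤c a′) p)))
  glue-adj (inj₁ a) (inj₂ j)  p = glue-attach a j p
  glue-adj (inj₂ j) (inj₁ a)  p = glue-attach a j (Sum.swap p)
  glue-adj (inj₂ j) (inj₂ j′) p = Adjacent⇒pathAdj {i = j} {j′} (Adjacent-+ˡ⁻ (suc c) p)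

  pathEmbedding : Embedding (P (suc (c + e))) (coalesce G u d)
  pathEmbedding = record
    { embed           = glue ∘ splitAt (suc c)
    ; embed-injective = λ {t} {t′} eq → trans (sym (FinP.join-splitAt (suc c) e t))
                          (trans (cong (join (suc c) e) (glue-injective eq)) (FinP.join-splitAt (suc c) e t′))
    ; embed-adj       = λ t t′ p → glue-adj (splitAt (suc c) t) (splitAt (suc c) t′)
                          (subst₂ Adjacent (toℕ≡position c e t) (toℕ≡position c e t′) (pathAdj⇒Adjacent p))
    }

  pathEmbedding-beyondPrefix : ∀ t → beyondPrefix c e t ≡ true
    → onFirstPendant G u d (embed pathEmbedding t) ≡ true
  pathEmbedding-beyondPrefix t = on-pendant (splitAt (suc c) t)
    where
    on-pendant : ∀ s → [ const false , const true ]′ s ≡ true → onFirstPendant G u d (glue s) ≡ true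
    on-pendant (inj₂ _) _  = refl
    on-pendant (inj₁ _) ()

+-exchange-trans : ∀ x s a r q b r′ → x + s ≤ a + r → a + q ≤ b + r′ → x + (q + s) ≤ b + (r′ + r)
+-exchange-trans x s a r q b r′ xs≤ar aq≤br′ = begin
  x + (q + s)   ≡⟨ x∙yz≈y∙xz x q s ⟩
  q + (x + s)   ≤⟨ +-monoʳ-≤ q xs≤ar ⟩
  q + (a + r)   ≡⟨ x∙yz≈yx∙z q a r ⟩
  (a + q) + r   ≤⟨ +-monoˡ-≤ r aq≤br′ ⟩
  (b + r′) + r  ≡⟨ +-assoc b r′ r ⟩
  b + (r′ + r)  ∎
  where open ≤-Reasoning

M-coalesce-≥ : ∀ {n m} {G : SimpleGraph n} {u : Fin n} → PathFrom G u m
  → ∀ {l} (c d : Fin l → ℕ) → (∀ i → c i ≤ m) → ∀ k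
  → M k (toGraph G) + sumL (allFin l) (λ i → M k (P (suc (c i + d i))))
    ≤ M k (coalesce G u d) + sumL (allFin l) (λ i → M k (P (suc (c i))))
M-coalesce-≥ {G = G} {u} γ {zero} c d c≤m k =
  +-monoˡ-≤ 0 (M-deletion-≤ (toGraph-enumerated G) (coalesce-enumerated G u d) (coalesce-noPendants G u d) k)
M-coalesce-≥ {G = G} {u} γ {suc l} c d c≤m k =
  subst₂ (λ s t → M k (toGraph G) + s ≤ M k (coalesce G u d) + t)
    (sym (sumL-allFin-suc l (λ i → M k (P (suc (c i + d i))))))
    (sym (sumL-allFin-suc l (λ i → M k (P (suc (c i))))))
    (+-exchange-trans (M k (toGraph G)) Σ-long (M k (coalesce G u (d ∘ fsuc))) Σ-short
                      (M k (P (suc (c fzero + d fzero)))) (M k (coalesce G u d)) (M k (P (suc (c fzero))))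
                      (M-coalesce-≥ γ (c ∘ fsuc) (d ∘ fsuc) (c≤m ∘ fsuc) k) first-pendant)
  where
  Σ-long Σ-short : ℕ
  Σ-long  = sumL (allFin l) (λ i → M k (P (suc (c (fsuc i) + d (fsuc i)))))
  Σ-short = sumL (allFin l) (λ i → M k (P (suc (c (fsuc i)))))

  first-pendant : M k (coalesce G u (d ∘ fsuc)) + M k (P (suc (c fzero + d fzero)))
                ≤ M k (coalesce G u d) + M k (P (suc (c fzero)))
  first-pendant = M-exchange
    (coalesce-enumerated G u (d ∘ fsuc)) (coalesce-enumerated G u d) (P-enumerated _) (P-enumerated _)
    (coalesce-dropFirst G u d) (prefix-deletion (c fzero) (d fzero))
    (pathEmbedding γ d (c≤m fzero)) (pathEmbedding-beyondPrefix γ d (c≤m fzero)) k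

maxF-upperBound : ∀ {l} (c : Fin l → ℕ) i → c i ≤ maxF c
maxF-upperBound c fzero    = m≤m⊔n _ _
maxF-upperBound c (fsuc i) = ≤-trans (maxF-upperBound (c ∘ fsuc) i) (m≤n⊔m (c fzero) _)

corollary1 : (n l : ℕ) → 1 ≤ l → (c d : Fin l → ℕ)
    → (∀ i → 1 ≤ c i) → (∀ i → 1 ≤ d i)
    → (G : SimpleGraph n) → Connected G → (u : Fin n)
    → ProperPathAt G u (maxF c)
    → (k : ℕ)
    → M k (toGraph G) + sumL (allFin l) (λ i → M k (P (suc (c i + d i))))
      ≤ M k (coalesce G u d) + sumL (allFin l) (λ i → M k (P (suc (c i))))
corollary1 n l _ c d _ _ G _ u path k =
  M-coalesce-≥ (properPath⇒PathFrom path) c d (maxF-upperBound c) k
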